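{- Let $k,t,a_1,a_2,\dots,a_t$ be positive integers such that $t\geq 4$ is even and $\frac{2k}{t-1}\leq a_1\leq a_2\leq\dots\leq a_t$. Then $\mathrm{rc}_k(K_{a_1,a_2,\dots,a_t})\leq 3$.
   Context: Given an edge coloring $c:E(G)\to[\ell]$, a path is rainbow if no two of its edges receive the same color. $(G,c)$ is rainbow $k$-connected if every pair of distinct vertices is joined by $k$ pairwise internally disjoint rainbow paths. The rainbow $k$-connection number $\mathrm{rc}_k(G)$ is the minimum $\ell$ such that some coloring $c:E(G)\to[\ell]$ makes $(G,c)$ rainbow $k$-connected. $K_{a_1,\dots,a_t}$ denotes the complete $t$-partite graph with parts of sizes $a_1,\dots,a_t$. -}

module Defs where

open import Data.Nat using (ℕ)
open import Data.Fin using (Fin)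
open import Data.List using (List; []; _∷_)
open import Data.List.Relation.Unary.Unique.Propositional using (Unique)
open import Data.List.Relation.Unary.All using (All)
open import Data.List.Membership.Propositional using (_∈_)
open import Data.Product using (Σ; ∃; _×_; proj₁)
open import Relation.Binary.PropositionalEquality using (_≡_; _≢_)
open import Relation.Nullary using (¬_)

KVertex : (t : ℕ) → (Fin t → ℕ) → Set
KVertex t a = Σ (Fin t) (λ i → Fin (a i))

KAdj : (t : ℕ) (a : Fin t → ℕ) → KVertex t a → KVertex t a → Set
KAdj t a u v = proj₁ u ≢ proj₁ v

module Graph {V : Set} (E : V → V → Set) where

  data Walk : V → V → Set where
    []  : ∀ {u} → Walk u u
    _∷_ : ∀ {u v w} → E u v → Walk v w → Walk u w

  verts : ∀ {u w} → Walk u w → List V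
  verts {u} [] = u ∷ []
  verts {u} (e ∷ p) = u ∷ verts p

  initVerts : ∀ {v w} → Walk v w → List V
  initVerts [] = []
  initVerts {v} (e ∷ p) = v ∷ initVerts p

  inner : ∀ {u w} → Walk u w → List V
  inner [] = []
  inner (e ∷ p) = initVerts p

  IsPath : ∀ {u w} → Walk u w → Set
  IsPath p = Unique (verts p)

  colours : ∀ {C : Set} (c : V → V → C) {u w} → Walk u w → List C
  colours c [] = []
  colours c (_∷_ {u} {v} e p) = c u v ∷ colours c p

  IsRainbowPath : ∀ {C : Set} (c : V → V → C) {u w} → Walk u w → Set
  IsRainbowPath c p = IsPath p × Unique (colours c p)

  InternallyDisjoint : ∀ {u w} → Walk u w → Walk u w → Set
  InternallyDisjoint p q =
    (verts p ≢ verts q) × All (λ x → ¬ (x ∈ inner q)) (inner p)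

  RainbowKConnected : ∀ {C : Set} → ℕ → (V → V → C) → Set
  RainbowKConnected {C} k c =
    ∀ (u w : V) → u ≢ w →
      Σ (Fin k → Walk u w) λ P →
        (∀ i → IsRainbowPath c (P i)) ×
        (∀ i j → i ≢ j → InternallyDisjoint (P i) (P j))

-- An edge colouring is represented as a
-- symmetric function on vertex pairs (values on non-edges are irrelevant).
rcK≤ : (k t : ℕ) (a : Fin t → ℕ) (ℓ : ℕ) → Set
rcK≤ k t a ℓ =
  Σ (KVertex t a → KVertex t a → Fin ℓ) λ c →
    (∀ u v → c u v ≡ c v u) × Graph.RainbowKConnected (KAdj t a) k c

module Submission where

-- Write t = 2q and pair the parts into q blocks of two parts each, the two "sides" of the
-- block.  An edge inside a block gets colour 2; an edge between different blocks gets colour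
-- 0 if its ends lie on equal sides and 1 otherwise.  All interior vertices of the paths below
-- are taken from the first a₁ vertices of each part, arranged in a₁ rows.
--
-- If u and w lie in different parts, every row carries at least q disjoint rainbow paths of
-- length two or three from u to w (mostly through single vertices of other blocks when u and
-- w are on opposite sides, and through both sides of another block when they are on the same
-- side), so there are at least q·a₁ ≥ (t − 1)a₁/2 ≥ k of them.  If u and w lie in the same
-- part, the other 2q − 1 parts are matched, two rows at a time, into 2q − 1 rainbow paths of
-- length three; the only delicate ones are those starting in the other side of u's block,
-- whose edges from u have colour 2.  This gives ⌊(t − 1)a₁/2⌋ ≥ k paths.

open import Defs
open import Data.Nat using (ℕ; zero; suc; _≤_; _<_; _*_; _+_; _∸_; z≤n; s≤s; _<?_)
open import Data.Nat.Properties
open import Data.Nat.Divisibility using (_∣_; divides)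
open import Data.Nat.Tactic.RingSolver using (solve-∀)
open import Data.Fin as Fin using (Fin; zero; suc; toℕ; combine; remQuot; punchIn; punchOut)
import Data.Fin.Properties as Finₚ
open import Data.List using (List; []; _∷_; _++_; map; concatMap; length; lookup; tabulate)
open import Data.List.Properties
  using (length-++; length-map; length-tabulate; concatMap-++; map-concatMap; ∷-injectiveʳ; ++-cancelʳ)
open import Data.List.Relation.Unary.All as All using (All; []; _∷_)
import Data.List.Relation.Unary.All.Properties as Allₚ
open import Data.List.Relation.Unary.AllPairs as AllPairs using ([]; _∷_)
open import Data.List.Relation.Unary.Any using (here; there)
open import Data.List.Relation.Unary.Unique.Propositional using (Unique)
import Data.List.Relation.Unary.Unique.Propositional.Properties as Uniqueₚ
open import Data.List.Membership.Propositional using (_∈_; _∉_)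
open import Data.List.Membership.Propositional.Properties using (∈-++⁺ʳ; ∈-++⁺ˡ; ∈-tabulate⁻; ∈-lookup)
open import Data.Product using (Σ; ∃; _×_; _,_; proj₁; proj₂)
open import Data.Empty using (⊥-elim)
open import Function using (_∘_)
open import Relation.Nullary using (yes; no)
open import Relation.Binary.PropositionalEquality

≢-resp : ∀ {A : Set} {x x′ y y′ : A} → x ≡ x′ → y ≡ y′ → x′ ≢ y′ → x ≢ y
≢-resp x≡x′ y≡y′ x′≢y′ x≡y = x′≢y′ (trans (sym x≡x′) (trans x≡y y≡y′))

Unique-++⇒∉ : ∀ {A : Set} (xs : List A) {ys : List A} {z : A} → Unique (xs ++ ys) → z ∈ xs → z ∉ ys
Unique-++⇒∉ (x ∷ xs) (x∉ ∷ _) (here refl) z∈ys = All.lookup x∉ (∈-++⁺ʳ xs z∈ys) refl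
Unique-++⇒∉ (x ∷ xs) (_ ∷ u)  (there z∈xs)    = Unique-++⇒∉ xs u z∈xs

Unique-++⁻ʳ : ∀ {A : Set} (xs : List A) {ys : List A} → Unique (xs ++ ys) → Unique ys
Unique-++⁻ʳ []       u       = u
Unique-++⁻ʳ (x ∷ xs) (_ ∷ u) = Unique-++⁻ʳ xs u

∈-concatMap⁺ : ∀ {A B : Set} (f : A → List B) (xs : List A) (i : Fin (length xs)) {z : B} →
               z ∈ f (lookup xs i) → z ∈ concatMap f xs
∈-concatMap⁺ f (x ∷ xs) zero    z∈ = ∈-++⁺ˡ z∈
∈-concatMap⁺ f (x ∷ xs) (suc i) z∈ = ∈-++⁺ʳ (f x) (∈-concatMap⁺ f xs i z∈)

Unique-concatMap⇒disjoint : ∀ {A B : Set} (f : A → List B) (xs : List A) → Unique (concatMap f xs) →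
  ∀ {i j} → i ≢ j → ∀ {z} → z ∈ f (lookup xs i) → z ∉ f (lookup xs j)
Unique-concatMap⇒disjoint f (x ∷ xs) u {zero}  {zero}  i≢j = ⊥-elim (i≢j refl)
Unique-concatMap⇒disjoint f (x ∷ xs) u {zero}  {suc j} _ z∈ z∈′ =
  Unique-++⇒∉ (f x) u z∈ (∈-concatMap⁺ f xs j z∈′)
Unique-concatMap⇒disjoint f (x ∷ xs) u {suc i} {zero}  _ z∈ z∈′ =
  Unique-++⇒∉ (f x) u z∈′ (∈-concatMap⁺ f xs i z∈)
Unique-concatMap⇒disjoint f (x ∷ xs) u {suc i} {suc j} i≢j =
  Unique-concatMap⇒disjoint f xs (Unique-++⁻ʳ (f x) u) (i≢j ∘ cong suc)

Unique-map⁺-injectiveOn : ∀ {A B : Set} {P : A → Set} (f : A → B) →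
  (∀ {x y} → P x → P y → f x ≡ f y → x ≡ y) → ∀ {xs} → All P xs → Unique xs → Unique (map f xs)
Unique-map⁺-injectiveOn f inj []         []        = []
Unique-map⁺-injectiveOn f inj (px ∷ pxs) (x∉ ∷ u) =
  Allₚ.map⁺ (All.zipWith (λ (py , x≢y) → x≢y ∘ inj px py) (pxs , x∉)) ∷ Unique-map⁺-injectiveOn f inj pxs u

2*m≤1+2*n⇒m≤n : ∀ m n → 2 * m ≤ suc (2 * n) → m ≤ n
2*m≤1+2*n⇒m≤n m n h = m<1+n⇒m≤n (*-cancelˡ-< 2 m (suc n) (begin-strict
  2 * m            ≤⟨ h ⟩
  suc (2 * n)      <⟨ n<1+n _ ⟩
  2 + 2 * n        ≡⟨ sym (*-suc 2 n) ⟩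
  2 * suc n        ∎))
  where open ≤-Reasoning

2*k≤[3+r*2]*a⇒k≤a*n : ∀ r a k n → 2 + r ≤ n → 2 * k ≤ (3 + r * 2) * a → k ≤ a * n
2*k≤[3+r*2]*a⇒k≤a*n r a k n 2+r≤n h = *-cancelˡ-≤ 2 (begin
  2 * k              ≤⟨ h ⟩
  (3 + r * 2) * a    ≤⟨ *-monoˡ-≤ a (n≤1+n (3 + r * 2)) ⟩
  (4 + r * 2) * a    ≡⟨ cong (_* a) (4+r*2≡2*[2+r] r) ⟩
  (2 * (2 + r)) * a  ≤⟨ *-monoˡ-≤ a (*-monoʳ-≤ 2 2+r≤n) ⟩
  (2 * n) * a        ≡⟨ [2*n]*a≡2*[a*n] n a ⟩
  2 * (a * n)        ∎)
  where
  open ≤-Reasoning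
  4+r*2≡2*[2+r] : ∀ r → 4 + r * 2 ≡ 2 * (2 + r)
  4+r*2≡2*[2+r] = solve-∀
  [2*n]*a≡2*[a*n] : ∀ n a → (2 * n) * a ≡ 2 * (a * n)
  [2*n]*a≡2*[a*n] = solve-∀

data Route (W : Set) : Set where
  via  : W → Route W
  via₂ : W → W → Route W

waypoints : ∀ {W : Set} → Route W → List W
waypoints (via x)    = x ∷ []
waypoints (via₂ x y) = x ∷ y ∷ []

module RainbowRoutes {V : Set} (E : V → V → Set) (E-irrefl : ∀ {x y} → E x y → x ≢ y)
                     {C : Set} (c : V → V → C) {W : Set} (ι : W → V)
                     (u w : V) (u≢w : u ≢ w) where
  open Graph E

  IsRainbowRoute : Route W → Set
  IsRainbowRoute (via x)    = E u (ι x) × E (ι x) w × c u (ι x) ≢ c (ι x) w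
  IsRainbowRoute (via₂ x y) = E u (ι x) × E (ι x) (ι y) × E (ι y) w × u ≢ ι y × ι x ≢ w ×
                              c u (ι x) ≢ c (ι x) (ι y) × c u (ι x) ≢ c (ι y) w × c (ι x) (ι y) ≢ c (ι y) w

  toWalk : (ρ : Route W) → IsRainbowRoute ρ → Walk u w
  toWalk (via x)    (ux , xw , _)      = ux ∷ xw ∷ []
  toWalk (via₂ x y) (ux , xy , yw , _) = ux ∷ xy ∷ yw ∷ []

  toWalk-rainbow : (ρ : Route W) (h : IsRainbowRoute ρ) → IsRainbowPath c (toWalk ρ h)
  toWalk-rainbow (via x) (ux , xw , c₁) =
    ((E-irrefl ux ∷ u≢w ∷ []) ∷ (E-irrefl xw ∷ []) ∷ [] ∷ []) , ((c₁ ∷ []) ∷ [] ∷ [])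
  toWalk-rainbow (via₂ x y) (ux , xy , yw , u≢y , x≢w , c₁ , c₂ , c₃) =
    ((E-irrefl ux ∷ u≢y ∷ u≢w ∷ []) ∷ (E-irrefl xy ∷ x≢w ∷ []) ∷ (E-irrefl yw ∷ []) ∷ [] ∷ []) ,
    ((c₁ ∷ c₂ ∷ []) ∷ (c₃ ∷ []) ∷ [] ∷ [])

  inner-toWalk : (ρ : Route W) (h : IsRainbowRoute ρ) → inner (toWalk ρ h) ≡ map ι (waypoints ρ)
  inner-toWalk (via x)    _ = refl
  inner-toWalk (via₂ x y) _ = refl

  verts-toWalk : (ρ : Route W) (h : IsRainbowRoute ρ) → verts (toWalk ρ h) ≡ u ∷ map ι (waypoints ρ) ++ w ∷ []
  verts-toWalk (via x)    _ = refl
  verts-toWalk (via₂ x y) _ = refl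

  some-waypoint : (ρ : Route W) → ∃ λ x → x ∈ map ι (waypoints ρ)
  some-waypoint (via x)    = ι x , here refl
  some-waypoint (via₂ x y) = ι x , here refl

  RainbowPaths : ℕ → Set
  RainbowPaths k = Σ (Fin k → Walk u w) λ P →
    (∀ i → IsRainbowPath c (P i)) × (∀ i j → i ≢ j → InternallyDisjoint (P i) (P j))

  rainbowPaths : (ρs : List (Route W)) → All IsRainbowRoute ρs → Unique (map ι (concatMap waypoints ρs)) →
                 ∀ k → k ≤ length ρs → RainbowPaths k
  rainbowPaths ρs rainbow unique k k≤ = P , (λ i → toWalk-rainbow _ _) , disjoint
    where
    route : Fin k → Route W
    route i = lookup ρs (Fin.inject≤ i k≤)

    interior : Fin k → List V
    interior i = map ι (waypoints (route i))

    P : Fin k → Walk u w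
    P i = toWalk (route i) (All.lookup rainbow (∈-lookup (Fin.inject≤ i k≤)))

    apart : ∀ {i j} → i ≢ j → ∀ {x} → x ∈ interior i → x ∉ interior j
    apart i≢j = Unique-concatMap⇒disjoint (map ι ∘ waypoints) ρs
                  (subst Unique (map-concatMap ι waypoints ρs) unique)
                  (i≢j ∘ Finₚ.inject≤-injective k≤ k≤ _ _)

    disjoint : ∀ i j → i ≢ j → InternallyDisjoint (P i) (P j)
    disjoint i j i≢j = distinct , All.tabulate λ x∈i x∈j →
      apart i≢j (subst (_ ∈_) (inner-toWalk _ _) x∈i) (subst (_ ∈_) (inner-toWalk _ _) x∈j)
      where
      distinct : verts (P i) ≢ verts (P j)
      distinct eq = apart i≢j x∈ (subst (x ∈_) same-interior x∈)
        where
        x = proj₁ (some-waypoint (route i))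
        x∈ = proj₂ (some-waypoint (route i))
        same-interior : interior i ≡ interior j
        same-interior = ++-cancelʳ (w ∷ []) (interior i) (interior j)
          (∷-injectiveʳ (trans (sym (verts-toWalk _ _)) (trans eq (verts-toWalk _ _))))

opposite : Fin 2 → Fin 2
opposite zero       = suc zero
opposite (suc zero) = zero

opposite-≢ : ∀ e → e ≢ opposite e
opposite-≢ zero       ()
opposite-≢ (suc zero) ()

blockColour : Fin 3
blockColour = suc (suc zero)

sideColour : Fin 2 → Fin 2 → Fin 3
sideColour zero       zero       = zero
sideColour zero       (suc zero) = suc zero
sideColour (suc zero) zero       = suc zero
sideColour (suc zero) (suc zero) = zero

sideColour≢blockColour : ∀ e e′ → sideColour e e′ ≢ blockColour
sideColour≢blockColour zero       zero       ()
sideColour≢blockColour zero       (suc zero) ()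
sideColour≢blockColour (suc zero) zero       ()
sideColour≢blockColour (suc zero) (suc zero) ()

sideColour-comm : ∀ e e′ → sideColour e e′ ≡ sideColour e′ e
sideColour-comm zero       zero       = refl
sideColour-comm zero       (suc zero) = refl
sideColour-comm (suc zero) zero       = refl
sideColour-comm (suc zero) (suc zero) = refl

sideColour-injectiveʳ : ∀ e {s s′} → sideColour e s ≡ sideColour e s′ → s ≡ s′
sideColour-injectiveʳ zero       {zero}     {zero}     _ = refl
sideColour-injectiveʳ zero       {suc zero} {suc zero} _ = refl
sideColour-injectiveʳ (suc zero) {zero}     {zero}     _ = refl
sideColour-injectiveʳ (suc zero) {suc zero} {suc zero} _ = refl
sideColour-injectiveʳ zero       {zero}     {suc zero} ()
sideColour-injectiveʳ zero       {suc zero} {zero}     ()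
sideColour-injectiveʳ (suc zero) {zero}     {suc zero} ()
sideColour-injectiveʳ (suc zero) {suc zero} {zero}     ()

sideColour-≢ : ∀ e s e′ → e ≢ e′ → sideColour e s ≢ sideColour s e′
sideColour-≢ e s e′ e≢e′ eq = e≢e′ (sideColour-injectiveʳ s (trans (sideColour-comm s e) eq))

module Construction (r : ℕ) (a : Fin (suc (suc r) * 2) → ℕ) (a₁ : ℕ)
                    (a₁≤a : ∀ i → a₁ ≤ a i) (1≤a : ∀ i → 1 ≤ a i) where

  Block : Set
  Block = Fin (suc (suc r))

  Part : Set
  Part = Fin (suc (suc r) * 2)

  Vertex : Set
  Vertex = KVertex (suc (suc r) * 2) a

  block : Part → Block
  block i = proj₁ (remQuot {suc (suc r)} 2 i)

  side : Part → Fin 2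
  side i = proj₂ (remQuot {suc (suc r)} 2 i)

  block-combine : ∀ (b : Block) (e : Fin 2) → block (combine b e) ≡ b
  block-combine b e = cong proj₁ (Finₚ.remQuot-combine b e)

  side-combine : ∀ (b : Block) (e : Fin 2) → side (combine b e) ≡ e
  side-combine b e = cong proj₂ (Finₚ.remQuot-combine b e)

  part-≡ : ∀ {i j} → block i ≡ block j → side i ≡ side j → i ≡ j
  part-≡ {i} {j} bi≡bj si≡sj = begin
    i                                   ≡⟨ sym (Finₚ.combine-remQuot {suc (suc r)} 2 i) ⟩
    combine (block i) (side i)          ≡⟨ cong₂ combine bi≡bj si≡sj ⟩
    combine (block j) (side j)          ≡⟨ Finₚ.combine-remQuot {suc (suc r)} 2 j ⟩
    j                                   ∎
    where open ≡-Reasoning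

  ≢-combineᵇ : ∀ {i : Part} {b : Block} (e : Fin 2) → block i ≢ b → i ≢ combine b e
  ≢-combineᵇ {b = b} e bi≢b i≡ = bi≢b (trans (cong block i≡) (block-combine b e))

  ≢-combineˢ : ∀ {i : Part} (b : Block) {e : Fin 2} → side i ≢ e → i ≢ combine b e
  ≢-combineˢ b {e} si≢e i≡ = si≢e (trans (cong side i≡) (side-combine b e))

  combine-≢ᵇ : ∀ {b b′ : Block} {e e′ : Fin 2} → b ≢ b′ → combine b e ≢ combine b′ e′
  combine-≢ᵇ {b} {b′} {e} {e′} b≢b′ eq = b≢b′ (proj₁ (Finₚ.combine-injective b e b′ e′ eq))

  combine-≢ˢ : ∀ {b b′ : Block} {e e′ : Fin 2} → e ≢ e′ → combine b e ≢ combine b′ e′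
  combine-≢ˢ {b} {b′} {e} {e′} e≢e′ eq = e≢e′ (proj₂ (Finₚ.combine-injective b e b′ e′ eq))

  adjacent⇒≢ : ∀ {x y : Vertex} → proj₁ x ≢ proj₁ y → x ≢ y
  adjacent⇒≢ x≢y = x≢y ∘ cong proj₁

  colour : Block → Fin 2 → Block → Fin 2 → Fin 3
  colour b e b′ e′ with b Finₚ.≟ b′
  ... | yes _ = blockColour
  ... | no  _ = sideColour e e′

  colour-sameBlock : ∀ b e e′ → colour b e b e′ ≡ blockColour
  colour-sameBlock b e e′ with b Finₚ.≟ b
  ... | yes _   = refl
  ... | no  b≢b = ⊥-elim (b≢b refl)

  colour-otherBlock : ∀ {b b′} e e′ → b ≢ b′ → colour b e b′ e′ ≡ sideColour e e′
  colour-otherBlock {b} {b′} e e′ b≢b′ with b Finₚ.≟ b′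
  ... | yes b≡b′ = ⊥-elim (b≢b′ b≡b′)
  ... | no  _    = refl

  colour-comm : ∀ b e b′ e′ → colour b e b′ e′ ≡ colour b′ e′ b e
  colour-comm b e b′ e′ with b Finₚ.≟ b′ | b′ Finₚ.≟ b
  ... | yes _    | yes _    = refl
  ... | yes b≡b′ | no  b′≢b = ⊥-elim (b′≢b (sym b≡b′))
  ... | no  b≢b′ | yes b′≡b = ⊥-elim (b≢b′ (sym b′≡b))
  ... | no  _    | no  _    = sideColour-comm e e′

  edgeColour : Vertex → Vertex → Fin 3
  edgeColour x y = colour (block (proj₁ x)) (side (proj₁ x)) (block (proj₁ y)) (side (proj₁ y))

  edgeColour-comm : ∀ x y → edgeColour x y ≡ edgeColour y x
  edgeColour-comm x y = colour-comm (block (proj₁ x)) (side (proj₁ x)) (block (proj₁ y)) (side (proj₁ y))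

  Slot : Set
  Slot = Block × Fin 2 × ℕ

  row : Slot → ℕ
  row (_ , _ , p) = p

  -- Rows at or beyond a₁ are sent to vertex 0 of the part; every slot used has row < a₁.
  atRow : (i : Part) → ℕ → Fin (a i)
  atRow i p with p <? a i
  ... | yes p<a = Fin.fromℕ< p<a
  ... | no  _   = Fin.fromℕ< (1≤a i)

  toℕ-atRow : ∀ i {p} → p < a i → toℕ (atRow i p) ≡ p
  toℕ-atRow i {p} p<a with p <? a i
  ... | yes p<a′ = Finₚ.toℕ-fromℕ< p<a′
  ... | no  p≮a  = ⊥-elim (p≮a p<a)

  vertex : Slot → Vertex
  vertex (b , e , p) = combine b e , atRow (combine b e) p

  vertex-injective : ∀ {s s′} → row s < a₁ → row s′ < a₁ → vertex s ≡ vertex s′ → s ≡ s′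
  vertex-injective {b , e , p} {b′ , e′ , p′} p<a₁ p′<a₁ eq
    with Finₚ.combine-injective b e b′ e′ (cong proj₁ eq)
  ... | refl , refl = cong (λ q → b , e , q) (begin
    p                           ≡⟨ sym (toℕ-atRow i (≤-trans p<a₁ (a₁≤a i))) ⟩
    toℕ (atRow i p)             ≡⟨ cong toℕ (second eq) ⟩
    toℕ (atRow i p′)            ≡⟨ toℕ-atRow i (≤-trans p′<a₁ (a₁≤a i)) ⟩
    p′                          ∎)
    where
    open ≡-Reasoning
    i = combine b e
    second : ∀ {x y : Fin (a i)} → _≡_ {A = Vertex} (i , x) (i , y) → x ≡ y
    second refl = refl

  edgeColour-toSlot : ∀ x b e p → edgeColour x (vertex (b , e , p)) ≡ colour (block (proj₁ x)) (side (proj₁ x)) b e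
  edgeColour-toSlot x b e p =
    cong₂ (colour (block (proj₁ x)) (side (proj₁ x))) (block-combine b e) (side-combine b e)

  edgeColour-fromSlot : ∀ b e p x → edgeColour (vertex (b , e , p)) x ≡ colour b e (block (proj₁ x)) (side (proj₁ x))
  edgeColour-fromSlot b e p x =
    cong₂ (λ b′ e′ → colour b′ e′ (block (proj₁ x)) (side (proj₁ x))) (block-combine b e) (side-combine b e)

  edgeColour-slots : ∀ b e p b′ e′ p′ →
                     edgeColour (vertex (b , e , p)) (vertex (b′ , e′ , p′)) ≡ colour b e b′ e′
  edgeColour-slots b e p b′ e′ p′ =
    trans (edgeColour-fromSlot b e p (vertex (b′ , e′ , p′))) (cong₂ (colour b e) (block-combine b′ e′) (side-combine b′ e′))

  slot≢ᵇ : ∀ {b b′ : Block} {x y : Fin 2 × ℕ} → b ≢ b′ → _≢_ {A = Slot} (b , x) (b′ , y)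
  slot≢ᵇ b≢b′ = b≢b′ ∘ cong proj₁

  slot≢ˢ : ∀ {b b′ : Block} {e e′ : Fin 2} {p p′ : ℕ} → e ≢ e′ →
           _≢_ {A = Slot} (b , e , p) (b′ , e′ , p′)
  slot≢ˢ e≢e′ = e≢e′ ∘ cong (proj₁ ∘ proj₂)

  slot≢ʳ : ∀ {b b′ : Block} {e e′ : Fin 2} {p p′ : ℕ} → p ≢ p′ →
           _≢_ {A = Slot} (b , e , p) (b′ , e′ , p′)
  slot≢ʳ p≢p′ = p≢p′ ∘ cong row

  Detour : Set
  Detour = Route Slot

  bothSides : List Block → ℕ → List Slot
  bothSides []       p = []
  bothSides (b ∷ bs) p = (b , zero , p) ∷ (b , suc zero , p) ∷ bothSides bs p

  singles : List Block → ℕ → List Detour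
  singles bs p = map via (bothSides bs p)

  crossings : List Block → ℕ → List Detour
  crossings bs p = map (λ b → via₂ (b , zero , p) (b , suc zero , p)) bs

  waypoints-singles : ∀ bs p → concatMap waypoints (singles bs p) ≡ bothSides bs p
  waypoints-singles bs p = go (bothSides bs p)
    where
    go : ∀ ss → concatMap waypoints (map via ss) ≡ ss
    go []       = refl
    go (s ∷ ss) = cong (s ∷_) (go ss)

  waypoints-crossings : ∀ bs p → concatMap waypoints (crossings bs p) ≡ bothSides bs p
  waypoints-crossings []       p = refl
  waypoints-crossings (b ∷ bs) p = cong (λ ss → (b , zero , p) ∷ (b , suc zero , p) ∷ ss) (waypoints-crossings bs p)

  length-singles : ∀ bs p → length (singles bs p) ≡ length bs + length bs
  length-singles bs p = trans (length-map via (bothSides bs p)) (go bs)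
    where
    go : ∀ bs → length (bothSides bs p) ≡ length bs + length bs
    go []       = refl
    go (b ∷ bs) = cong suc (trans (cong suc (go bs)) (sym (+-suc (length bs) (length bs))))

  length-crossings : ∀ bs p → length (crossings bs p) ≡ length bs
  length-crossings bs p = length-map _ bs

  bothSides-all : ∀ {P : Slot → Set} bs p → (∀ {b} → b ∈ bs → ∀ e → P (b , e , p)) → All P (bothSides bs p)
  bothSides-all []       p f = []
  bothSides-all (b ∷ bs) p f = f (here refl) zero ∷ f (here refl) (suc zero) ∷ bothSides-all bs p (f ∘ there)

  bothSides-unique : ∀ {bs} p → Unique bs → Unique (bothSides bs p)
  bothSides-unique {[]}     p []          = []
  bothSides-unique {b ∷ bs} p (b∉ ∷ uniq) =
    (slot≢ˢ Finₚ.0≢1+n ∷ elsewhere) ∷ elsewhere ∷ bothSides-unique p uniq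
    where
    elsewhere : ∀ {e} → All ((b , e , p) ≢_) (bothSides bs p)
    elsewhere = bothSides-all bs p (λ z∈ _ → slot≢ᵇ (All.lookup b∉ z∈))

  blocksExcept : Block → List Block
  blocksExcept b = tabulate (punchIn b)

  blocksExcept-unique : ∀ b → Unique (blocksExcept b)
  blocksExcept-unique b = Uniqueₚ.tabulate⁺ (Finₚ.punchIn-injective b _ _)

  ∈blocksExcept⇒≢ : ∀ b {z} → z ∈ blocksExcept b → z ≢ b
  ∈blocksExcept⇒≢ b z∈ with ∈-tabulate⁻ {f = punchIn b} z∈
  ... | y , refl = Finₚ.punchInᵢ≢i b y

  length-blocksExcept : ∀ b → length (blocksExcept b) ≡ suc r
  length-blocksExcept b = length-tabulate (punchIn b)

  blocksExcept₂ : (b b′ : Block) → b ≢ b′ → List Block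
  blocksExcept₂ b b′ b≢b′ = tabulate (punchIn b ∘ punchIn (punchOut b≢b′))

  blocksExcept₂-unique : ∀ b b′ b≢b′ → Unique (blocksExcept₂ b b′ b≢b′)
  blocksExcept₂-unique b b′ b≢b′ =
    Uniqueₚ.tabulate⁺ (Finₚ.punchIn-injective (punchOut b≢b′) _ _ ∘ Finₚ.punchIn-injective b _ _)

  ∈blocksExcept₂⇒≢ˡ : ∀ {b b′ b≢b′ z} → z ∈ blocksExcept₂ b b′ b≢b′ → z ≢ b
  ∈blocksExcept₂⇒≢ˡ {b} {b′} {b≢b′} z∈ with ∈-tabulate⁻ {f = punchIn b ∘ punchIn (punchOut b≢b′)} z∈
  ... | y , refl = Finₚ.punchInᵢ≢i b _

  ∈blocksExcept₂⇒≢ʳ : ∀ {b b′ b≢b′ z} → z ∈ blocksExcept₂ b b′ b≢b′ → z ≢ b′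
  ∈blocksExcept₂⇒≢ʳ {b} {b′} {b≢b′} z∈ with ∈-tabulate⁻ {f = punchIn b ∘ punchIn (punchOut b≢b′)} z∈
  ... | y , refl = λ eq → Finₚ.punchInᵢ≢i (punchOut b≢b′) y
                            (Finₚ.punchIn-injective b _ _ (trans eq (sym (Finₚ.punchIn-punchOut b≢b′))))

  length-blocksExcept₂ : ∀ b b′ b≢b′ → length (blocksExcept₂ b b′ b≢b′) ≡ r
  length-blocksExcept₂ b b′ b≢b′ = length-tabulate _

  record Within (l h : ℕ) (s : Slot) : Set where
    constructor within
    field
      row≥ : l ≤ row s
      row< : row s < h

  DistinctBelow : ℕ → List Detour → Set
  DistinctBelow h ds = Unique (concatMap waypoints ds) × All (λ s → row s < h) (concatMap waypoints ds)

  DistinctWithin : ℕ → ℕ → List Detour → Set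
  DistinctWithin l h ds = Unique (concatMap waypoints ds) × All (Within l h) (concatMap waypoints ds)

  ++-unique-byRows : ∀ {m} {xs ys : List Slot} → Unique xs → All (λ s → row s < m) xs →
                     Unique ys → All (λ s → m ≤ row s) ys → Unique (xs ++ ys)
  ++-unique-byRows ux below uy above =
    Uniqueₚ.++⁺ ux uy λ (s∈xs , s∈ys) → <⇒≱ (All.lookup below s∈xs) (All.lookup above s∈ys)

  distinctBelow-++ : ∀ {m n} ds ds′ → m ≤ n → DistinctBelow m ds → DistinctWithin m n ds′ →
                     DistinctBelow n (ds ++ ds′)
  distinctBelow-++ ds ds′ m≤n (u , below) (u′ , inside) rewrite concatMap-++ waypoints ds ds′ =
    ++-unique-byRows u below u′ (All.map Within.row≥ inside) ,
    Allₚ.++⁺ (All.map (λ s<m → ≤-trans s<m m≤n) below) (All.map Within.row< inside)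

  bothSides-distinct : ∀ {bs p} ds → concatMap waypoints ds ≡ bothSides bs p → Unique bs →
                       DistinctWithin p (suc p) ds
  bothSides-distinct {bs} {p} ds eq ub rewrite eq =
    bothSides-unique p ub , bothSides-all bs p (λ _ _ → within ≤-refl ≤-refl)

  flanked-distinct : ∀ {b b′ x y bs p} ds → concatMap waypoints ds ≡ bothSides bs p → b ≢ b′ →
                     (∀ {z} → z ∈ bs → z ≢ b) → (∀ {z} → z ∈ bs → z ≢ b′) → Unique bs →
                     DistinctWithin p (suc p) (via (b , x , p) ∷ via (b′ , y , p) ∷ ds)
  flanked-distinct {bs = bs} {p} ds eq b≢b′ ≢b ≢b′ ub rewrite eq =
    ((slot≢ᵇ b≢b′ ∷ avoid ≢b) ∷ avoid ≢b′ ∷ bothSides-unique p ub) ,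
    within ≤-refl ≤-refl ∷ within ≤-refl ≤-refl ∷ bothSides-all bs p (λ _ _ → within ≤-refl ≤-refl)
    where
    avoid : ∀ {c x} → (∀ {z} → z ∈ bs → z ≢ c) → All ((c , x) ≢_) (bothSides bs p)
    avoid ≢c = bothSides-all bs p (λ z∈ _ → slot≢ᵇ (≢-sym (≢c z∈)))

  byRows : (ℕ → List Detour) → ℕ → List Detour
  byRows R zero    = []
  byRows R (suc m) = byRows R m ++ R m

  byRows-all : ∀ {P : Detour → Set} R → (∀ p → All P (R p)) → ∀ m → All P (byRows R m)
  byRows-all R all zero    = []
  byRows-all R all (suc m) = Allₚ.++⁺ (byRows-all R all m) (all m)

  byRows-distinct : ∀ R → (∀ p → DistinctWithin p (suc p) (R p)) → ∀ m → DistinctBelow m (byRows R m)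
  byRows-distinct R distinct zero    = [] , []
  byRows-distinct R distinct (suc m) =
    distinctBelow-++ (byRows R m) (R m) (n≤1+n m) (byRows-distinct R distinct m) (distinct m)

  length-byRows : ∀ R {n} → (∀ p → length (R p) ≡ n) → ∀ m → length (byRows R m) ≡ m * n
  length-byRows R         length≡ zero    = refl
  length-byRows R {n} length≡ (suc m) = begin
    length (byRows R m ++ R m)          ≡⟨ length-++ (byRows R m) ⟩
    length (byRows R m) + length (R m)  ≡⟨ cong₂ _+_ (length-byRows R length≡ m) (length≡ m) ⟩
    m * n + n                           ≡⟨ +-comm (m * n) n ⟩
    suc m * n                           ∎
    where open ≡-Reasoning

  -- Here u and w lie in part (b, e).  The gadgets through the other side of block b end in
  -- block X, so the slots of X in row m + 1 are left out of the crossings.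
  module SamePart (b : Block) (e : Fin 2) where

    X : Block
    X = punchIn b zero

    rest : List Block
    rest = tabulate (punchIn b ∘ suc)

    X≢b : X ≢ b
    X≢b = ∈blocksExcept⇒≢ b (here refl)

    rest⇒≢b : ∀ {z} → z ∈ rest → z ≢ b
    rest⇒≢b = ∈blocksExcept⇒≢ b ∘ there

    rest⇒≢X : ∀ {z} → z ∈ rest → z ≢ X
    rest⇒≢X = ≢-sym ∘ All.lookup (AllPairs.head (blocksExcept-unique b))

    rest-unique : Unique rest
    rest-unique = AllPairs.tail (blocksExcept-unique b)

    length-rest : length rest ≡ r
    length-rest = suc-injective (length-blocksExcept b)

    twoRows : ℕ → List Detour
    twoRows m = via₂ (b , opposite e , m) (X , zero , suc m) ∷ via₂ (b , opposite e , suc m) (X , suc zero , suc m) ∷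
                crossings (blocksExcept b) m ++ crossings rest (suc m)

    samePartDetours : ℕ → List Detour
    samePartDetours zero          = []
    samePartDetours (suc zero)    = crossings (blocksExcept b) zero
    samePartDetours (suc (suc m)) = samePartDetours m ++ twoRows m

    twoRowsSlots : ℕ → List Slot
    twoRowsSlots m = (b , opposite e , m) ∷ (X , zero , suc m) ∷ (b , opposite e , suc m) ∷ (X , suc zero , suc m) ∷
                     bothSides (blocksExcept b) m ++ bothSides rest (suc m)

    twoRows-waypoints : ∀ m → concatMap waypoints (twoRows m) ≡ twoRowsSlots m
    twoRows-waypoints m =
      cong (λ ss → (b , opposite e , m) ∷ (X , zero , suc m) ∷ (b , opposite e , suc m) ∷ (X , suc zero , suc m) ∷ ss)
        (trans (concatMap-++ waypoints (crossings (blocksExcept b) m) (crossings rest (suc m)))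
               (cong₂ _++_ (waypoints-crossings (blocksExcept b) m) (waypoints-crossings rest (suc m))))

    twoRows-distinct : ∀ m → DistinctWithin m (2 + m) (twoRows m)
    twoRows-distinct m rewrite twoRows-waypoints m = unique , inside
      where
      b≢X : b ≢ X
      b≢X = ≢-sym X≢b

      m≢1+m : m ≢ suc m
      m≢1+m = ≢-sym 1+n≢n

      avoid : ∀ {c} x → (∀ {z} → z ∈ rest → z ≢ c) →
              All ((c , x) ≢_) (bothSides rest m ++ bothSides rest (suc m))
      avoid x ≢c = Allₚ.++⁺ (bothSides-all rest m (λ z∈ _ → slot≢ᵇ (≢-sym (≢c z∈))))
                            (bothSides-all rest (suc m) (λ z∈ _ → slot≢ᵇ (≢-sym (≢c z∈))))

      unique : Unique (twoRowsSlots m)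
      unique =
        (slot≢ᵇ b≢X ∷ slot≢ʳ m≢1+m ∷ slot≢ᵇ b≢X ∷ slot≢ᵇ b≢X ∷ slot≢ᵇ b≢X ∷ avoid _ rest⇒≢b) ∷
        (slot≢ᵇ X≢b ∷ slot≢ˢ Finₚ.0≢1+n ∷ slot≢ʳ 1+n≢n ∷ slot≢ˢ Finₚ.0≢1+n ∷ avoid _ rest⇒≢X) ∷
        (slot≢ᵇ b≢X ∷ slot≢ᵇ b≢X ∷ slot≢ᵇ b≢X ∷ avoid _ rest⇒≢b) ∷
        (slot≢ˢ (≢-sym Finₚ.0≢1+n) ∷ slot≢ʳ 1+n≢n ∷ avoid _ rest⇒≢X) ∷
        (slot≢ˢ Finₚ.0≢1+n ∷ avoid _ rest⇒≢X) ∷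
        avoid _ rest⇒≢X ∷
        ++-unique-byRows (bothSides-unique m rest-unique) (bothSides-all rest m (λ _ _ → ≤-refl))
                         (bothSides-unique (suc m) rest-unique) (bothSides-all rest (suc m) (λ _ _ → ≤-refl))

      lower : ∀ {c x} → Within m (2 + m) (c , x , m)
      lower = within ≤-refl (n≤1+n (suc m))

      upper : ∀ {c x} → Within m (2 + m) (c , x , suc m)
      upper = within (n≤1+n m) ≤-refl

      inside : All (Within m (2 + m)) (twoRowsSlots m)
      inside = lower ∷ upper ∷ upper ∷ upper ∷ lower ∷ lower ∷
               Allₚ.++⁺ (bothSides-all rest m (λ _ _ → lower)) (bothSides-all rest (suc m) (λ _ _ → upper))

    samePartDetours-distinct : ∀ m → DistinctBelow m (samePartDetours m)
    samePartDetours-distinct zero          = [] , []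
    samePartDetours-distinct (suc zero)    =
      distinctBelow-++ [] (crossings (blocksExcept b) zero) z≤n ([] , [])
        (bothSides-distinct (crossings (blocksExcept b) zero) (waypoints-crossings (blocksExcept b) zero) (blocksExcept-unique b))
    samePartDetours-distinct (suc (suc m)) =
      distinctBelow-++ (samePartDetours m) (twoRows m) (m≤n+m m 2) (samePartDetours-distinct m) (twoRows-distinct m)

    length-twoRows : ∀ m → length (twoRows m) ≡ 3 + r * 2
    length-twoRows m = begin
      2 + length (crossings (blocksExcept b) m ++ crossings rest (suc m))
        ≡⟨ cong (2 +_) (length-++ (crossings (blocksExcept b) m)) ⟩
      2 + (length (crossings (blocksExcept b) m) + length (crossings rest (suc m)))
        ≡⟨ cong₂ (λ x y → 2 + (x + y)) (trans (length-crossings (blocksExcept b) m) (length-blocksExcept b))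
                                      (trans (length-crossings rest (suc m)) length-rest) ⟩
      2 + (suc r + r)                                                      ≡⟨ 2+[1+r+r]≡3+r*2 r ⟩
      3 + r * 2                                                            ∎
      where
      open ≡-Reasoning
      2+[1+r+r]≡3+r*2 : ∀ r → 2 + (suc r + r) ≡ 3 + r * 2
      2+[1+r+r]≡3+r*2 = solve-∀

    length-samePartDetours : ∀ m → (3 + r * 2) * m ≤ suc (2 * length (samePartDetours m))
    length-samePartDetours zero          = ≤-trans (≤-reflexive (*-zeroʳ (3 + r * 2))) z≤n
    length-samePartDetours (suc zero)    = ≤-reflexive (begin
      (3 + r * 2) * 1                                 ≡⟨ [3+r*2]*1≡1+2*[1+r] r ⟩
      suc (2 * suc r)
        ≡⟨ cong (λ l → suc (2 * l)) (sym (trans (length-crossings (blocksExcept b) zero) (length-blocksExcept b))) ⟩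
      suc (2 * length (crossings (blocksExcept b) 0)) ∎)
      where
      open ≡-Reasoning
      [3+r*2]*1≡1+2*[1+r] : ∀ r → (3 + r * 2) * 1 ≡ suc (2 * suc r)
      [3+r*2]*1≡1+2*[1+r] = solve-∀
    length-samePartDetours (suc (suc m)) = begin
      (3 + r * 2) * (2 + m)                                    ≡⟨ split r m ⟩
      (3 + r * 2) * m + 2 * (3 + r * 2)                        ≤⟨ +-monoˡ-≤ _ (length-samePartDetours m) ⟩
      suc (2 * length (samePartDetours m)) + 2 * (3 + r * 2)   ≡⟨ merge (length (samePartDetours m)) (3 + r * 2) ⟩
      suc (2 * (length (samePartDetours m) + (3 + r * 2)))     ≡⟨ cong (λ l → suc (2 * l)) (sym length≡) ⟩
      suc (2 * length (samePartDetours (suc (suc m))))         ∎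
      where
      open ≤-Reasoning
      split : ∀ r m → (3 + r * 2) * (2 + m) ≡ (3 + r * 2) * m + 2 * (3 + r * 2)
      split = solve-∀
      merge : ∀ l n → suc (2 * l) + 2 * n ≡ suc (2 * (l + n))
      merge = solve-∀
      length≡ : length (samePartDetours m ++ twoRows m) ≡ length (samePartDetours m) + (3 + r * 2)
      length≡ = trans (length-++ (samePartDetours m)) (cong (length (samePartDetours m) +_) (length-twoRows m))

  module Endpoints (u w : Vertex) (u≢w : u ≢ w) where
    open RainbowRoutes (KAdj _ a) adjacent⇒≢ edgeColour vertex u w u≢w

    bu : Block
    bu = block (proj₁ u)

    su : Fin 2
    su = side (proj₁ u)

    bw : Block
    bw = block (proj₁ w)

    sw : Fin 2
    sw = side (proj₁ w)

    colour-into : ∀ {b} s p → b ≢ bu → edgeColour u (vertex (b , s , p)) ≡ sideColour su s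
    colour-into {b} s p b≢bu = trans (edgeColour-toSlot u b s p) (colour-otherBlock su s (≢-sym b≢bu))

    colour-outOf : ∀ {b} s p → b ≢ bw → edgeColour (vertex (b , s , p)) w ≡ sideColour s sw
    colour-outOf {b} s p b≢bw = trans (edgeColour-fromSlot b s p w) (colour-otherBlock s sw b≢bw)

    colour-intoOwnBlock : ∀ s p → edgeColour u (vertex (bu , s , p)) ≡ blockColour
    colour-intoOwnBlock s p = trans (edgeColour-toSlot u bu s p) (colour-sameBlock bu su s)

    colour-outOfOwnBlock : ∀ s p → edgeColour (vertex (bw , s , p)) w ≡ blockColour
    colour-outOfOwnBlock s p = trans (edgeColour-fromSlot bw s p w) (colour-sameBlock bw s sw)

    through-otherBlock : ∀ {b} s p → b ≢ bu → b ≢ bw → su ≢ sw → IsRainbowRoute (via (b , s , p))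
    through-otherBlock s p b≢bu b≢bw su≢sw =
      ≢-combineᵇ s (≢-sym b≢bu) , ≢-sym (≢-combineᵇ s (≢-sym b≢bw)) ,
      ≢-resp (colour-into s p b≢bu) (colour-outOf s p b≢bw) (sideColour-≢ su s sw su≢sw)

    through-ownBlock : ∀ s p → su ≢ s → bu ≢ bw → IsRainbowRoute (via (bu , s , p))
    through-ownBlock s p su≢s bu≢bw =
      ≢-combineˢ bu su≢s , ≢-sym (≢-combineᵇ s (≢-sym bu≢bw)) ,
      ≢-resp (colour-intoOwnBlock s p) (colour-outOf s p bu≢bw) (≢-sym (sideColour≢blockColour s sw))

    through-targetBlock : ∀ s p → sw ≢ s → bu ≢ bw → IsRainbowRoute (via (bw , s , p))
    through-targetBlock s p sw≢s bu≢bw =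
      ≢-combineᵇ s bu≢bw , ≢-sym (≢-combineˢ bw sw≢s) ,
      ≢-resp (colour-into s p (≢-sym bu≢bw)) (colour-outOfOwnBlock s p) (sideColour≢blockColour su s)

    through₂-crossing : ∀ {b} p → b ≢ bu → b ≢ bw → su ≡ sw →
                        IsRainbowRoute (via₂ (b , zero , p) (b , suc zero , p))
    through₂-crossing {b} p b≢bu b≢bw su≡sw =
      ≢-combineᵇ zero (≢-sym b≢bu) , combine-≢ˢ {b} {b} Finₚ.0≢1+n ,
      ≢-sym (≢-combineᵇ (suc zero) (≢-sym b≢bw)) ,
      adjacent⇒≢ (≢-combineᵇ (suc zero) (≢-sym b≢bu)) , adjacent⇒≢ (≢-sym (≢-combineᵇ zero (≢-sym b≢bw))) ,
      ≢-resp (colour-into zero p b≢bu) across (sideColour≢blockColour su zero) ,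
      ≢-resp (colour-into zero p b≢bu) (colour-outOf (suc zero) p b≢bw) sides-differ ,
      ≢-resp across (colour-outOf (suc zero) p b≢bw) (≢-sym (sideColour≢blockColour (suc zero) sw))
      where
      across : edgeColour (vertex (b , zero , p)) (vertex (b , suc zero , p)) ≡ blockColour
      across = trans (edgeColour-slots b zero p b (suc zero) p) (colour-sameBlock b zero (suc zero))
      sides-differ : sideColour su zero ≢ sideColour (suc zero) sw
      sides-differ eq = Finₚ.0≢1+n (sideColour-injectiveʳ su
        (trans eq (trans (sideColour-comm (suc zero) sw) (cong (λ e → sideColour e (suc zero)) (sym su≡sw)))))

    through₂-gadget : ∀ {X} s p p′ → X ≢ bu → proj₁ u ≡ proj₁ w →
                      IsRainbowRoute (via₂ (bu , opposite su , p) (X , s , p′))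
    through₂-gadget {X} s p p′ X≢bu iu≡iw =
      ≢-combineˢ bu (opposite-≢ su) , combine-≢ᵇ (≢-sym X≢bu) , ≢-sym (≢-combineᵇ s (≢-sym X≢bw)) ,
      adjacent⇒≢ (≢-combineᵇ s (≢-sym X≢bu)) , adjacent⇒≢ (≢-sym (≢-combineˢ bu sw≢opposite)) ,
      ≢-resp (colour-intoOwnBlock (opposite su) p) across (≢-sym (sideColour≢blockColour (opposite su) s)) ,
      ≢-resp (colour-intoOwnBlock (opposite su) p) (colour-outOf s p′ X≢bw) (≢-sym (sideColour≢blockColour s sw)) ,
      ≢-resp across (colour-outOf s p′ X≢bw) (sideColour-≢ (opposite su) s sw (≢-sym sw≢opposite))
      where
      X≢bw : X ≢ bw
      X≢bw X≡bw = X≢bu (trans X≡bw (cong block (sym iu≡iw)))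
      sw≢opposite : sw ≢ opposite su
      sw≢opposite = subst (_≢ opposite su) (cong side iu≡iw) (opposite-≢ su)
      across : edgeColour (vertex (bu , opposite su , p)) (vertex (X , s , p′)) ≡ sideColour (opposite su) s
      across = trans (edgeColour-slots bu (opposite su) p X s p′) (colour-otherBlock (opposite su) s (≢-sym X≢bu))

    singles-rainbow : ∀ {bs} p → (∀ {z} → z ∈ bs → z ≢ bu × z ≢ bw) → su ≢ sw →
                      All IsRainbowRoute (singles bs p)
    singles-rainbow {bs} p avoids su≢sw =
      Allₚ.map⁺ (bothSides-all bs p λ z∈ s →
        through-otherBlock s p (proj₁ (avoids z∈)) (proj₂ (avoids z∈)) su≢sw)

    crossings-rainbow : ∀ {bs} p → (∀ {z} → z ∈ bs → z ≢ bu × z ≢ bw) → su ≡ sw →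
                        All IsRainbowRoute (crossings bs p)
    crossings-rainbow p avoids su≡sw =
      Allₚ.map⁺ (All.tabulate λ z∈ → through₂-crossing p (proj₁ (avoids z∈)) (proj₂ (avoids z∈)) su≡sw)

    paths : (ds : List Detour) → All IsRainbowRoute ds → DistinctBelow a₁ ds →
            ∀ k → k ≤ length ds → RainbowPaths k
    paths ds rainbow (unique , below) =
      rainbowPaths ds rainbow (Unique-map⁺-injectiveOn vertex vertex-injective below unique)

    pathsByRows : (R : ℕ → List Detour) (n : ℕ) → 2 + r ≤ n → (∀ p → All IsRainbowRoute (R p)) →
                  (∀ p → DistinctWithin p (suc p) (R p)) → (∀ p → length (R p) ≡ n) →
                  ∀ k → 2 * k ≤ (3 + r * 2) * a₁ → RainbowPaths k
    pathsByRows R n 2+r≤n rainbow distinct length≡ k hk =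
      paths (byRows R a₁) (byRows-all R rainbow a₁) (byRows-distinct R distinct a₁) k
        (subst (k ≤_) (sym (length-byRows R length≡ a₁)) (2*k≤[3+r*2]*a⇒k≤a*n r a₁ k n 2+r≤n hk))

    samePart : proj₁ u ≡ proj₁ w → ∀ k → 2 * k ≤ (3 + r * 2) * a₁ → RainbowPaths k
    samePart iu≡iw k hk =
      paths (samePartDetours a₁) (rainbow a₁) (samePartDetours-distinct a₁) k
        (2*m≤1+2*n⇒m≤n k _ (≤-trans hk (length-samePartDetours a₁)))
      where
      open SamePart bu su

      crossings-avoiding : ∀ {bs} p → (∀ {z} → z ∈ bs → z ≢ bu) → All IsRainbowRoute (crossings bs p)
      crossings-avoiding p ≢bu =
        crossings-rainbow p (λ z∈ → ≢bu z∈ , subst (_ ≢_) (cong block iu≡iw) (≢bu z∈)) (cong side iu≡iw)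

      rainbow : ∀ m → All IsRainbowRoute (samePartDetours m)
      rainbow zero          = []
      rainbow (suc zero)    = crossings-avoiding zero (∈blocksExcept⇒≢ bu)
      rainbow (suc (suc m)) = Allₚ.++⁺ (rainbow m)
        (through₂-gadget zero m (suc m) X≢b iu≡iw ∷ through₂-gadget (suc zero) (suc m) (suc m) X≢b iu≡iw ∷
         Allₚ.++⁺ (crossings-avoiding m (∈blocksExcept⇒≢ bu)) (crossings-avoiding (suc m) rest⇒≢b))

    sameBlock : bu ≡ bw → su ≢ sw → ∀ k → 2 * k ≤ (3 + r * 2) * a₁ → RainbowPaths k
    sameBlock bu≡bw su≢sw = pathsByRows (singles others) (suc r + suc r) (s≤s (m≤n+m (suc r) r))
      (λ p → singles-rainbow p (λ z∈ → ∈blocksExcept⇒≢ bu z∈ , subst (_ ≢_) bu≡bw (∈blocksExcept⇒≢ bu z∈)) su≢sw)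
      (λ p → bothSides-distinct (singles others p) (waypoints-singles others p) (blocksExcept-unique bu))
      (λ p → trans (length-singles others p) (cong₂ _+_ (length-blocksExcept bu) (length-blocksExcept bu)))
      where
      others : List Block
      others = blocksExcept bu

    crossBlock-oppositeSides : bu ≢ bw → su ≢ sw → ∀ k → 2 * k ≤ (3 + r * 2) * a₁ → RainbowPaths k
    crossBlock-oppositeSides bu≢bw su≢sw = pathsByRows R (2 + (r + r)) (s≤s (s≤s (m≤n+m r r)))
      (λ p → through-ownBlock sw p su≢sw bu≢bw ∷ through-targetBlock su p (≢-sym su≢sw) bu≢bw ∷
             singles-rainbow p (λ z∈ → ∈blocksExcept₂⇒≢ˡ z∈ , ∈blocksExcept₂⇒≢ʳ z∈) su≢sw)
      (λ p → flanked-distinct (singles others p) (waypoints-singles others p) bu≢bw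
               ∈blocksExcept₂⇒≢ˡ ∈blocksExcept₂⇒≢ʳ (blocksExcept₂-unique bu bw bu≢bw))
      (λ p → cong (2 +_) (trans (length-singles others p)
               (cong₂ _+_ (length-blocksExcept₂ bu bw bu≢bw) (length-blocksExcept₂ bu bw bu≢bw))))
      where
      others : List Block
      others = blocksExcept₂ bu bw bu≢bw
      R : ℕ → List Detour
      R p = via (bu , sw , p) ∷ via (bw , su , p) ∷ singles others p

    crossBlock-sameSide : bu ≢ bw → su ≡ sw → ∀ k → 2 * k ≤ (3 + r * 2) * a₁ → RainbowPaths k
    crossBlock-sameSide bu≢bw su≡sw = pathsByRows R (2 + r) ≤-refl
      (λ p → through-ownBlock (opposite su) p (opposite-≢ su) bu≢bw ∷
             through-targetBlock (opposite su) p (subst (_≢ opposite su) su≡sw (opposite-≢ su)) bu≢bw ∷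
             crossings-rainbow p (λ z∈ → ∈blocksExcept₂⇒≢ˡ z∈ , ∈blocksExcept₂⇒≢ʳ z∈) su≡sw)
      (λ p → flanked-distinct (crossings others p) (waypoints-crossings others p) bu≢bw
               ∈blocksExcept₂⇒≢ˡ ∈blocksExcept₂⇒≢ʳ (blocksExcept₂-unique bu bw bu≢bw))
      (λ p → cong (2 +_) (trans (length-crossings others p) (length-blocksExcept₂ bu bw bu≢bw)))
      where
      others : List Block
      others = blocksExcept₂ bu bw bu≢bw
      R : ℕ → List Detour
      R p = via (bu , opposite su , p) ∷ via (bw , opposite su , p) ∷ crossings others p

    rainbowPaths-uw : ∀ k → 2 * k ≤ (3 + r * 2) * a₁ → RainbowPaths k
    rainbowPaths-uw with proj₁ u Finₚ.≟ proj₁ w | bu Finₚ.≟ bw | su Finₚ.≟ sw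
    ... | yes iu≡iw | _         | _         = samePart iu≡iw
    ... | no  iu≢iw | yes bu≡bw | yes su≡sw = ⊥-elim (iu≢iw (part-≡ bu≡bw su≡sw))
    ... | no  _     | yes bu≡bw | no  su≢sw = sameBlock bu≡bw su≢sw
    ... | no  _     | no  bu≢bw | yes su≡sw = crossBlock-sameSide bu≢bw su≡sw
    ... | no  _     | no  bu≢bw | no  su≢sw = crossBlock-oppositeSides bu≢bw su≢sw

  rainbowConnected : ∀ k → 2 * k ≤ (3 + r * 2) * a₁ → rcK≤ k (suc (suc r) * 2) a 3
  rainbowConnected k hk = edgeColour , edgeColour-comm , λ u w u≢w → Endpoints.rainbowPaths-uw u w u≢w k hk

mainTheorem4 : (k t : ℕ) (a : Fin t → ℕ) →
    1 ≤ k → 4 ≤ t → 2 ∣ t → (∀ i → 1 ≤ a i) →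
    (∀ i j → toℕ i ≤ toℕ j → a i ≤ a j) →
    (∀ (i : Fin t) → toℕ i ≡ 0 → 2 * k ≤ (t ∸ 1) * a i) →
    rcK≤ k t a 3
mainTheorem4 k .(0 * 2)               a _ ()                (divides zero refl)          _   _    _
mainTheorem4 k .(1 * 2)               a _ (s≤s (s≤s ()))    (divides (suc zero) refl)    _   _    _
mainTheorem4 k .(suc (suc r) * 2)     a _ _                 (divides (suc (suc r)) refl) 1≤a mono a₁-bound =
  Construction.rainbowConnected r a (a zero) (λ i → mono zero i z≤n) 1≤a k (a₁-bound zero refl)
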